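{- Let $P$ be a poset such that $\textup{mxl}(P)$ is a cutset of $P$. Suppose that every $C\in \Gamma(P,\textup{mxl}(P))$ has a maximum element. Let $P_{0}=\{\max C \mid C\in \Gamma(P,\textup{mxl}(P))\}$ (as a subposet of $P$) and let $i\colon P_{0}\to P$ be the inclusion map. Then: (a) there exists an order-preserving retraction $r\colon P\to P_{0}$ (so $ri=\textup{id}_{P_0}$) such that $ir\geq \textup{id}_P$; in particular, $P_{0}$ is a strong deformation retract of $P$; (b) the posets $\Gamma(P,\textup{mxl}(P))$ and $P_{0}$ are isomorphic.
   Context: $\textup{mxl}(P)$ is the set of maximal elements of $P$. For $a\in P$, $\textnormal{st}_P(a)=\{x\in P\mid x\leq a \text{ or } x\geq a\}$; for non-empty $A\subseteq P$, $\textnormal{st}_P(A)=\bigcap_{a\in A}\textnormal{st}_P(a)$. $X\subseteq P$ is a cutset if for every finite chain $\sigma$ of $P$ there is $a\in X$ with $\sigma\cup\{a\}$ a chain. The crosscut poset $\Gamma(P,X)$ is the set of connected components (w.r.t. comparability) of the non-empty subposets $\textnormal{st}_P(A)$, $A$ a non-empty subset of $X$, ordered by inclusion. Posets are topological spaces via the Alexandroff topology whose open sets are the down-sets; $f\geq g$ for maps into a poset means $f(x)\geq g(x)$ for all $x$. -}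

module Defs where

open import Level using (Level; _⊔_; suc)
open import Data.Product using (Σ; ∃; _×_; _,_)
open import Data.Sum using (_⊎_)
open import Data.List using (List)
open import Data.List.Relation.Unary.All using (All)
open import Relation.Binary using (Rel)
open import Relation.Binary.PropositionalEquality using (_≡_)
open import Relation.Unary using (Pred; _⊆_)

-- Definitions relative to a (carrier, order) pair; the poset axioms are
-- assumed separately in the statement (IsPartialOrder _≡_ _≤_).
module PosetDefs {c ℓ : Level} {A : Set c} (_≤_ : Rel A ℓ) where

  Subset : Set (suc (c ⊔ ℓ))
  Subset = Pred A (c ⊔ ℓ)

  Comparable : A → A → Set ℓ
  Comparable x y = (x ≤ y) ⊎ (y ≤ x)

  Mxl : Subset
  Mxl a = ∀ x → a ≤ x → x ≡ a

  IsChain : List A → Set (c ⊔ ℓ)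
  IsChain σ = All (λ x → All (Comparable x) σ) σ

  IsCutset : Subset → Set (c ⊔ ℓ)
  IsCutset X = (σ : List A) → IsChain σ → Σ A (λ a → X a × All (Comparable a) σ)

  st₁ : A → Pred A ℓ
  st₁ a x = Comparable x a

  St : Subset → Subset
  St B x = ∀ a → B a → st₁ a x

  data Conn (S : Subset) : A → A → Set (c ⊔ ℓ) where
    base : ∀ {x} → S x → Conn S x x
    step : ∀ {x y z} → Conn S x y → S z → Comparable y z → Conn S x z

  Component : Subset → A → Subset
  Component S x y = Conn S x y

  -- an element of Γ(P, X): a non-empty B ⊆ X together with a point x ∈ st_P(B);
  -- it represents the component of st_P(B) containing x
  record ΓElt (X : Subset) : Set (suc (c ⊔ ℓ)) where
    constructor γ
    field
      gen       : Subset
      gen⊆X     : gen ⊆ X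
      gen≠∅     : ∃ gen
      point     : A
      point∈st  : St gen point

  ⟦_⟧ : ∀ {X} → ΓElt X → Subset
  ⟦ C ⟧ = Component (St (ΓElt.gen C)) (ΓElt.point C)

  _⊑Γ_ : ∀ {X} → ΓElt X → ΓElt X → Set (c ⊔ ℓ)
  C ⊑Γ D = ⟦ C ⟧ ⊆ ⟦ D ⟧

  _≅Γ_ : ∀ {X} → ΓElt X → ΓElt X → Set (c ⊔ ℓ)
  C ≅Γ D = (C ⊑Γ D) × (D ⊑Γ C)

  IsMaximum : Subset → A → Set (c ⊔ ℓ)
  IsMaximum S m = S m × (∀ y → S y → y ≤ m)

  HasMaximum : Subset → Set (c ⊔ ℓ)
  HasMaximum S = ∃ (IsMaximum S)

  InP₀ : Subset → A → Set (suc (c ⊔ ℓ))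
  InP₀ X m = Σ (ΓElt X) (λ C → IsMaximum ⟦ C ⟧ m)

  P₀ : Subset → Set (suc (c ⊔ ℓ))
  P₀ X = Σ A (InP₀ X)

  incl : ∀ {X} → P₀ X → A
  incl (m , _) = m

-- Since mxl(P) is a cutset, every x lies below some maximal element, so the component of x in
-- st(maximal elements above x) is an element Γ↑ x of Γ. It is the least element of Γ containing
-- x: a component of st(B), B ⊆ mxl(P), that contains x has every b ∈ B above x. Such components
-- are also down-closed, since a point of st(B) lies below all of B. Hence x ↦ max (Γ↑ x) is
-- monotone, lies above x and fixes P₀, and C ↦ max C is an order isomorphism Γ ≅ P₀.
module Submission where

open import Defs
open import Level using (Level)
open import Data.Product using (Σ; _×_; _,_; proj₁; proj₂)
open import Data.Sum using (inj₁; inj₂; swap)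
open import Data.List using ([]; _∷_)
open import Data.List.Relation.Unary.All using ([]; _∷_)
open import Function using (id)
open import Relation.Binary using (Rel; IsPartialOrder)
open import Relation.Binary.PropositionalEquality using (_≡_)
open import Relation.Unary using (_⊆_)

module Components {c ℓ : Level} {A : Set c} (_≤_ : Rel A ℓ) where
  open PosetDefs _≤_

  Conn-end : ∀ {S x y} → Conn S x y → S y
  Conn-end (base s)     = s
  Conn-end (step _ s _) = s

  Conn-map : ∀ {S T : Subset} → S ⊆ T → ∀ {x y} → Conn S x y → Conn T x y
  Conn-map S⊆T (base s)      = base (S⊆T s)
  Conn-map S⊆T (step k s xy) = step (Conn-map S⊆T k) (S⊆T s) xy

  Conn-trans : ∀ {S x y z} → Conn S x y → Conn S y z → Conn S x z
  Conn-trans k (base _)       = k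
  Conn-trans k (step k′ s yz) = step (Conn-trans k k′) s yz

  St-antitone : ∀ {B B′ : Subset} → B ⊆ B′ → St B′ ⊆ St B
  St-antitone B⊆B′ s a a∈B = s a (B⊆B′ a∈B)

  IsMaximum-mono : ∀ {S T : Subset} {m n} → S ⊆ T → IsMaximum S m → IsMaximum T n → m ≤ n
  IsMaximum-mono S⊆T (m∈S , _) (_ , n-max) = n-max _ (S⊆T m∈S)

module Crosscut {c ℓ : Level} {A : Set c} {_≤_ : Rel A ℓ} (po : IsPartialOrder _≡_ _≤_) where
  open PosetDefs _≤_
  open Components _≤_
  open IsPartialOrder po using (refl; trans; antisym; reflexive)

  IsMaximum-unique : ∀ {S : Subset} {m n} → IsMaximum S m → IsMaximum S n → m ≡ n
  IsMaximum-unique m-max n-max = antisym (IsMaximum-mono id m-max n-max) (IsMaximum-mono id n-max m-max)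

  Comparable-Mxl⇒≤ : ∀ {x a} → Mxl a → Comparable x a → x ≤ a
  Comparable-Mxl⇒≤ _     (inj₁ x≤a) = x≤a
  Comparable-Mxl⇒≤ a-mxl (inj₂ a≤x) = reflexive (a-mxl _ a≤x)

  MxlAbove : A → Subset
  MxlAbove x a = Mxl a × x ≤ a

  ≤⇒St-MxlAbove : ∀ {x z} → z ≤ x → St (MxlAbove x) z
  ≤⇒St-MxlAbove z≤x a (_ , x≤a) = inj₁ (trans z≤x x≤a)

  St⇒⊆MxlAbove : ∀ {B : Subset} {x} → B ⊆ Mxl → St B x → B ⊆ MxlAbove x
  St⇒⊆MxlAbove B⊆Mxl x∈St {a} a∈B = B⊆Mxl a∈B , Comparable-Mxl⇒≤ (B⊆Mxl a∈B) (x∈St a a∈B)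

  St-Mxl-downClosed : ∀ {B : Subset} {x y} → B ⊆ Mxl → y ≤ x → St B x → St B y
  St-Mxl-downClosed B⊆Mxl y≤x x∈St =
    St-antitone (St⇒⊆MxlAbove B⊆Mxl x∈St) (≤⇒St-MxlAbove y≤x)

  ⟦⟧-downClosed : (C : ΓElt Mxl) → ∀ {x y} → y ≤ x → ⟦ C ⟧ x → ⟦ C ⟧ y
  ⟦⟧-downClosed C y≤x k = step k (St-Mxl-downClosed (ΓElt.gen⊆X C) y≤x (Conn-end k)) (inj₂ y≤x)

  IsMaximum-≤⇒⊑Γ : (C D : ΓElt Mxl) → ∀ {m n} → IsMaximum ⟦ C ⟧ m → ⟦ D ⟧ n → m ≤ n → C ⊑Γ D
  IsMaximum-≤⇒⊑Γ C D (_ , m-max) n∈D m≤n y∈C = ⟦⟧-downClosed D (trans (m-max _ y∈C) m≤n) n∈D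

  module Cutset (cut : IsCutset Mxl) where

    MxlAbove-nonempty : ∀ x → Σ A (MxlAbove x)
    MxlAbove-nonempty x with cut (x ∷ []) ((inj₁ refl ∷ []) ∷ [])
    ... | a , a-mxl , (a~x ∷ []) = a , a-mxl , Comparable-Mxl⇒≤ a-mxl (swap a~x)

    Γ↑ : A → ΓElt Mxl
    Γ↑ x = γ (MxlAbove x) proj₁ (MxlAbove-nonempty x) x (≤⇒St-MxlAbove refl)

    x∈Γ↑x : ∀ x → ⟦ Γ↑ x ⟧ x
    x∈Γ↑x x = base (≤⇒St-MxlAbove refl)

    Γ↑-least : (C : ΓElt Mxl) → ∀ {x} → ⟦ C ⟧ x → Γ↑ x ⊑Γ C
    Γ↑-least C x∈C y∈Γ↑x =
      Conn-trans x∈C (Conn-map (St-antitone (St⇒⊆MxlAbove (ΓElt.gen⊆X C) (Conn-end x∈C))) y∈Γ↑x)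

    Γ↑-mono : ∀ {x y} → x ≤ y → Γ↑ x ⊑Γ Γ↑ y
    Γ↑-mono x≤y = Γ↑-least (Γ↑ _) (⟦⟧-downClosed (Γ↑ _) x≤y (x∈Γ↑x _))

    module Maxima (hasMax : (C : ΓElt Mxl) → HasMaximum ⟦ C ⟧) where

      max : ΓElt Mxl → P₀ Mxl
      max C = proj₁ (hasMax C) , C , proj₂ (hasMax C)

      max-isMaximum : (C : ΓElt Mxl) → IsMaximum ⟦ C ⟧ (incl (max C))
      max-isMaximum C = proj₂ (hasMax C)

      max-mono : ∀ C D → C ⊑Γ D → incl (max C) ≤ incl (max D)
      max-mono C D C⊑D = IsMaximum-mono C⊑D (max-isMaximum C) (max-isMaximum D)

      component : P₀ Mxl → ΓElt Mxl
      component (_ , C , _) = C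

      component-mono : ∀ p q → incl p ≤ incl q → component p ⊑Γ component q
      component-mono (_ , C , p-max) (_ , D , q∈D , _) = IsMaximum-≤⇒⊑Γ C D p-max q∈D

      max-component : ∀ p → incl (max (component p)) ≡ incl p
      max-component (_ , C , p-max) = IsMaximum-unique (max-isMaximum C) p-max

      retract : A → P₀ Mxl
      retract x = max (Γ↑ x)

      retract-mono : ∀ x y → x ≤ y → incl (retract x) ≤ incl (retract y)
      retract-mono x y x≤y = max-mono (Γ↑ x) (Γ↑ y) (Γ↑-mono x≤y)

      ≤retract : ∀ x → x ≤ incl (retract x)
      ≤retract x = proj₂ (max-isMaximum (Γ↑ x)) x (x∈Γ↑x x)

      retract-incl : ∀ p → incl (retract (incl p)) ≡ incl p
      retract-incl (m , C , m∈C , m-max) =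
        antisym (m-max _ (Γ↑-least C m∈C (proj₁ (max-isMaximum (Γ↑ m))))) (≤retract m)

theorem3p16 : {c ℓ : Level} {A : Set c} (_≤_ : Rel A ℓ) → IsPartialOrder _≡_ _≤_ →
    let open PosetDefs _≤_ in
    IsCutset Mxl →
    ((C : ΓElt Mxl) → HasMaximum ⟦ C ⟧) →
    Σ (A → P₀ Mxl) (λ r →
        (∀ x y → x ≤ y → incl (r x) ≤ incl (r y))
      × (∀ (p : P₀ Mxl) → incl (r (incl p)) ≡ incl p)
      × (∀ x → x ≤ incl (r x)))
    ×
    Σ (ΓElt Mxl → P₀ Mxl) (λ f → Σ (P₀ Mxl → ΓElt Mxl) (λ g →
        (∀ C D → C ⊑Γ D → incl (f C) ≤ incl (f D))
      × (∀ p q → incl p ≤ incl q → g p ⊑Γ g q)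
      × (∀ C → g (f C) ≅Γ C)
      × (∀ p → incl (f (g p)) ≡ incl p)))
theorem3p16 _≤_ po cut hasMax =
    (retract , retract-mono , retract-incl , ≤retract)
  , (max , component , max-mono , component-mono , (λ C → id , id) , max-component)
  where open Crosscut.Cutset.Maxima po cut hasMax
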